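{- Let $\tau$ be a finite set of nodes. Then $\tau$ is a connected skew shape if and only if every pair $u,v\in\tau$ satisfies: (i) if $u\searrow v$, then every ${\sf S}/{\sf E}$ path from $u$ to $v$ is contained in $\tau$; and (ii) if $u\nearrow v$, then there exists an ${\sf N}/{\sf E}$ path from $u$ to $v$ contained in $\tau$.
   Context: Nodes are elements of $\mathbb{Z}\times\mathbb{Z}$; $u=(u_1,u_2)$ lies in row $u_1$ (increasing southward), column $u_2$ (increasing eastward). ${\sf N}(i,j)=(i-1,j)$, ${\sf E}(i,j)=(i,j+1)$, ${\sf S}(i,j)=(i+1,j)$, ${\sf W}(i,j)=(i,j-1)$. $u\searrow v$ means $v=u+(k,\ell)$ with $k,\ell\ge0$; $u\nearrow v$ means $v=u+(-k,\ell)$ with $k,\ell\ge0$. A path from $u$ to $v$ is a sequence of nodes $z^1=u,\dots,z^k=v$ with each $z^{i+1}\in\{{\sf N}z^i,{\sf E}z^i,{\sf S}z^i,{\sf W}z^i\}$; it is an ${\sf N}/{\sf E}$ path (resp. ${\sf S}/{\sf E}$ path) if each $z^{i+1}\in\{{\sf N}z^i,{\sf E}z^i\}$ (resp. $\{{\sf S}z^i,{\sf E}z^i\}$). A finite set $\tau$ of nodes is a skew shape if $u,w\in\tau$, $u\searrow v\searrow w$ imply $v\in\tau$; connected if any two of its nodes are joined by a path contained in $\tau$. -}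

module Defs where

open import Data.Integer using (ℤ; _+_; _-_; _≤_; +_; 1ℤ)
open import Data.Product using (_×_; _,_; ∃; ∃-syntax)
open import Data.Sum using (_⊎_)
open import Data.List using (List; []; _∷_)
open import Data.List.Membership.Propositional using (_∈_)
open import Relation.Binary.PropositionalEquality using (_≡_)

-- A node (i , j): row i (increasing southward), column j (increasing eastward).
Node : Set
Node = ℤ × ℤ

N E S W : Node → Node
N (i , j) = (i - 1ℤ , j)
E (i , j) = (i , j + 1ℤ)
S (i , j) = (i + 1ℤ , j)
W (i , j) = (i , j - 1ℤ)

_↘_ : Node → Node → Set
(u₁ , u₂) ↘ (v₁ , v₂) = (u₁ ≤ v₁) × (u₂ ≤ v₂)

_↗_ : Node → Node → Set
(u₁ , u₂) ↗ (v₁ , v₂) = (v₁ ≤ u₁) × (u₂ ≤ v₂)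

AnyStep : Node → Node → Set
AnyStep z z' = (z' ≡ N z) ⊎ (z' ≡ E z) ⊎ (z' ≡ S z) ⊎ (z' ≡ W z)

NEStep : Node → Node → Set
NEStep z z' = (z' ≡ N z) ⊎ (z' ≡ E z)

SEStep : Node → Node → Set
SEStep z z' = (z' ≡ S z) ⊎ (z' ≡ E z)

-- IsWalk R zs u v : the (nonempty) sequence u ∷ zs of nodes starts at u,
-- ends at v, and consecutive nodes are related by R.
data IsWalk (R : Node → Node → Set) : Node → List Node → Node → Set where
  stop : ∀ {u} → IsWalk R u [] u
  step : ∀ {u w zs v} → R u w → IsWalk R w zs v → IsWalk R u (w ∷ zs) v

PathIn : List Node → Node → List Node → Set
PathIn τ u zs = (u ∈ τ) × (∀ {z} → z ∈ zs → z ∈ τ)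

IsSkewShape : List Node → Set
IsSkewShape τ = ∀ {u v w} → u ∈ τ → w ∈ τ → u ↘ v → v ↘ w → v ∈ τ

IsConnected : List Node → Set
IsConnected τ = ∀ {u v} → u ∈ τ → v ∈ τ →
  ∃[ zs ] (IsWalk AnyStep u zs v × PathIn τ u zs)

-- If u ↗ v in a connected skew shape τ, walk greedily from u: a north or east
-- neighbour of the current node x towards v lies in τ unless x is a
-- north-east corner of τ (N x, E x ∉ τ) strictly south-west of v. At such a
-- corner the skew condition forbids τ from having nodes north-west or
-- south-east of it, so every path in τ starting at x stays south-west of x
-- and cannot reach v, against connectivity. Condition (i) is immediate since
-- the nodes of an S/E path from u to v lie between u and v. Conversely, (i)
-- applied to an S/E path through v gives convexity, and (i), (ii) together
-- with path reversal connect any two nodes.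
module Submission where

open import Defs
open import Data.Product using (_×_; ∃-syntax; _,_; proj₁; proj₂)
open import Data.Product.Properties using (≡-dec)
open import Data.List using (List; []; _∷_; _++_)
open import Data.List.Membership.Propositional using (_∈_; _∉_)
open import Data.List.Membership.Propositional.Properties using (∈-++⁺ˡ)
import Data.List.Membership.DecPropositional as DecMembership
open import Data.List.Relation.Unary.Any using (here; there)
open import Data.Integer
  using (ℤ; _+_; _-_; _≤_; _<_; +_; 1ℤ; 0ℤ; -1ℤ; ∣_∣; _≤?_; _≟_; pred; +≤+)
  renaming (suc to sucℤ)
import Data.Integer.Properties as ℤ
open import Data.Integer.Tactic.RingSolver using (solve-∀)
open import Data.Nat using (zero; suc)
import Data.Nat.Properties as ℕ
open import Data.Sum using (_⊎_; inj₁; inj₂)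
open import Data.Empty using (⊥-elim)
open import Function.Base using (_∘_)
open import Function.Bundles using (_⇔_; mk⇔)
open import Relation.Nullary using (Dec; yes; no)
open import Relation.Binary.PropositionalEquality using (_≡_; refl; sym; trans; cong; cong₂)

i<j⇒i+1≤j : ∀ {i j} → i < j → i + 1ℤ ≤ j
i<j⇒i+1≤j {i} i<j rewrite ℤ.+-comm i 1ℤ = ℤ.i<j⇒suc[i]≤j i<j

i<j⇒i≤j-1 : ∀ {i j} → i < j → i ≤ j - 1ℤ
i<j⇒i≤j-1 {j = j} i<j rewrite ℤ.+-comm j -1ℤ = ℤ.i<j⇒i≤pred[j] i<j

i≤i+1 : ∀ i → i ≤ i + 1ℤ
i≤i+1 i = ℤ.i≤i+j i 1ℤ

i-1≤i : ∀ i → i - 1ℤ ≤ i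
i-1≤i i = ℤ.i-j≤i i 1ℤ

i≡i-1+1 : ∀ i → i ≡ (i - 1ℤ) + 1ℤ
i≡i-1+1 = solve-∀

i≡i+1-1 : ∀ i → i ≡ (i + 1ℤ) - 1ℤ
i≡i+1-1 = solve-∀

nonneg-+≡0 : ∀ {i j} → 0ℤ ≤ i → 0ℤ ≤ j → i + j ≡ 0ℤ → i ≡ 0ℤ × j ≡ 0ℤ
nonneg-+≡0 (+≤+ {n = m} _) (+≤+ _) eq =
  cong +_ (ℕ.m+n≡0⇒m≡0 m (ℤ.+-injective eq)) , cong +_ (ℕ.m+n≡0⇒n≡0 m (ℤ.+-injective eq))

_∈?_ : (x : Node) (xs : List Node) → Dec (x ∈ xs)
_∈?_ = DecMembership._∈?_ (≡-dec _≟_ _≟_)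

↘-refl : ∀ {x} → x ↘ x
↘-refl = ℤ.≤-refl , ℤ.≤-refl

↘-trans : ∀ {x y z} → x ↘ y → y ↘ z → x ↘ z
↘-trans (p₁ , p₂) (q₁ , q₂) = ℤ.≤-trans p₁ q₁ , ℤ.≤-trans p₂ q₂

↗-refl : ∀ {x} → x ↗ x
↗-refl = ℤ.≤-refl , ℤ.≤-refl

↗-antisym : ∀ {x y} → x ↗ y → y ↗ x → x ≡ y
↗-antisym (p₁ , p₂) (q₁ , q₂) = cong₂ _,_ (ℤ.≤-antisym q₁ p₁) (ℤ.≤-antisym p₂ q₂)

SEStep⇒↘ : ∀ {x y} → SEStep x y → x ↘ y
SEStep⇒↘ {x₁ , x₂} (inj₁ refl) = i≤i+1 x₁ , ℤ.≤-refl
SEStep⇒↘ {x₁ , x₂} (inj₂ refl) = ℤ.≤-refl , i≤i+1 x₂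

SEStep⇒AnyStep : ∀ {x y} → SEStep x y → AnyStep x y
SEStep⇒AnyStep (inj₁ y≡Sx) = inj₂ (inj₂ (inj₁ y≡Sx))
SEStep⇒AnyStep (inj₂ y≡Ex) = inj₂ (inj₁ y≡Ex)

NEStep⇒AnyStep : ∀ {x y} → NEStep x y → AnyStep x y
NEStep⇒AnyStep (inj₁ y≡Nx) = inj₁ y≡Nx
NEStep⇒AnyStep (inj₂ y≡Ex) = inj₂ (inj₁ y≡Ex)

AnyStep-sym : ∀ {x y} → AnyStep x y → AnyStep y x
AnyStep-sym {i , j} (inj₁ refl) = inj₂ (inj₂ (inj₁ (cong₂ _,_ (i≡i-1+1 i) refl)))
AnyStep-sym {i , j} (inj₂ (inj₁ refl)) = inj₂ (inj₂ (inj₂ (cong₂ _,_ refl (i≡i+1-1 j))))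
AnyStep-sym {i , j} (inj₂ (inj₂ (inj₁ refl))) = inj₁ (cong₂ _,_ (i≡i+1-1 i) refl)
AnyStep-sym {i , j} (inj₂ (inj₂ (inj₂ refl))) = inj₂ (inj₁ (cong₂ _,_ refl (i≡i-1+1 j)))

module _ {R : Node → Node → Set} where

  walk-++ : ∀ {x zs y ys w} → IsWalk R x zs y → IsWalk R y ys w → IsWalk R x (zs ++ ys) w
  walk-++ stop q = q
  walk-++ (step r p) q = step r (walk-++ p q)

  walk-end : ∀ {x zs y} → IsWalk R x zs y → y ≡ x ⊎ y ∈ zs
  walk-end stop = inj₁ refl
  walk-end (step r p) with walk-end p
  ... | inj₁ refl = inj₂ (here refl)
  ... | inj₂ y∈zs = inj₂ (there y∈zs)

  walk-map : ∀ {R′ : Node → Node → Set} → (∀ {x y} → R x y → R′ x y) →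
    ∀ {x zs y} → IsWalk R x zs y → IsWalk R′ x zs y
  walk-map f stop = stop
  walk-map f (step r p) = step (f r) (walk-map f p)

  walk-preserves : ∀ {P Q : Node → Set} → (∀ {x y} → P x → R x y → Q y → P y) →
    ∀ {x zs y} → IsWalk R x zs y → (∀ {z} → z ∈ zs → Q z) → P x → P y
  walk-preserves keep stop _ px = px
  walk-preserves keep (step r p) qs px =
    walk-preserves keep p (λ z∈zs → qs (there z∈zs)) (keep px r (qs (here refl)))

  walk-reverse-in : (∀ {x y} → R x y → R y x) → ∀ {τ u zs v} →
    IsWalk R u zs v → PathIn τ u zs → ∃[ ys ] (IsWalk R v ys u × PathIn τ v ys)
  walk-reverse-in R-sym p p∈τ = reverse-onto p p∈τ stop (proj₁ p∈τ , λ ())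
    where
    reverse-onto : ∀ {τ u w zs v acc} → IsWalk R w zs v → PathIn τ w zs →
      IsWalk R w acc u → PathIn τ w acc → ∃[ ys ] (IsWalk R v ys u × PathIn τ v ys)
    reverse-onto stop _ q q∈τ = _ , q , q∈τ
    reverse-onto (step r p) (w∈τ , zs⊆τ) q (_ , acc⊆τ) =
      reverse-onto p (zs⊆τ (here refl) , λ z∈zs → zs⊆τ (there z∈zs))
        (step (R-sym r) q)
        (zs⊆τ (here refl) , λ { (here refl) → w∈τ ; (there z∈acc) → acc⊆τ z∈acc })

module _ {R : Node → Node → Set} {P : Node → Set} {v : Node} (gap : Node → ℤ)
  (gap-nonneg : ∀ {x} → P x → 0ℤ ≤ gap x)
  (gap≡0⇒≡ : ∀ {x} → P x → gap x ≡ 0ℤ → x ≡ v)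
  (advance : ∀ {x} → P x → x ≡ v ⊎ ∃[ y ] (R x y × P y × gap x ≡ sucℤ (gap y)))
  where

  walk-by-descent : ∀ {x} → P x → ∃[ zs ] (IsWalk R x zs v × (∀ {z} → z ∈ zs → P z))
  walk-by-descent {x} px = descend ∣ gap x ∣ (sym (ℤ.0≤i⇒+∣i∣≡i (gap-nonneg px))) px
    where
    descend : ∀ n {x} → gap x ≡ + n → P x → ∃[ zs ] (IsWalk R x zs v × (∀ {z} → z ∈ zs → P z))
    descend zero gap≡0 px with gap≡0⇒≡ px gap≡0
    ... | refl = [] , stop , λ ()
    descend (suc n) gap≡1+n px with advance px
    ... | inj₁ refl = [] , stop , λ ()
    ... | inj₂ (y , r , py , gap-step) with descend n gap[y]≡n py
      where
      gap[y]≡n : gap y ≡ + n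
      gap[y]≡n = trans (sym (ℤ.pred-suc (gap y))) (cong pred (trans (sym gap-step) gap≡1+n))
    ...   | zs , p , ps = y ∷ zs , step r p , λ { (here refl) → py ; (there z∈zs) → ps z∈zs }

↘-gap : Node → Node → ℤ
↘-gap (x₁ , x₂) (v₁ , v₂) = (v₁ - x₁) + (v₂ - x₂)

↗-gap : Node → Node → ℤ
↗-gap (x₁ , x₂) (v₁ , v₂) = (x₁ - v₁) + (v₂ - x₂)

↘-gap-nonneg : ∀ {x v} → x ↘ v → 0ℤ ≤ ↘-gap x v
↘-gap-nonneg (p₁ , p₂) = ℤ.+-mono-≤ (ℤ.i≤j⇒0≤j-i p₁) (ℤ.i≤j⇒0≤j-i p₂)

↗-gap-nonneg : ∀ {x v} → x ↗ v → 0ℤ ≤ ↗-gap x v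
↗-gap-nonneg (p₁ , p₂) = ℤ.+-mono-≤ (ℤ.i≤j⇒0≤j-i p₁) (ℤ.i≤j⇒0≤j-i p₂)

↘-gap≡0⇒≡ : ∀ {x v} → x ↘ v → ↘-gap x v ≡ 0ℤ → x ≡ v
↘-gap≡0⇒≡ {x₁ , x₂} {v₁ , v₂} (p₁ , p₂) gap≡0
  with nonneg-+≡0 (ℤ.i≤j⇒0≤j-i p₁) (ℤ.i≤j⇒0≤j-i p₂) gap≡0
... | d₁≡0 , d₂≡0 = sym (cong₂ _,_ (ℤ.i-j≡0⇒i≡j v₁ x₁ d₁≡0) (ℤ.i-j≡0⇒i≡j v₂ x₂ d₂≡0))

↗-gap≡0⇒≡ : ∀ {x v} → x ↗ v → ↗-gap x v ≡ 0ℤ → x ≡ v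
↗-gap≡0⇒≡ {x₁ , x₂} {v₁ , v₂} (p₁ , p₂) gap≡0
  with nonneg-+≡0 (ℤ.i≤j⇒0≤j-i p₁) (ℤ.i≤j⇒0≤j-i p₂) gap≡0
... | d₁≡0 , d₂≡0 = cong₂ _,_ (ℤ.i-j≡0⇒i≡j x₁ v₁ d₁≡0) (sym (ℤ.i-j≡0⇒i≡j v₂ x₂ d₂≡0))

↘-gap-S : ∀ x v → ↘-gap x v ≡ sucℤ (↘-gap (S x) v)
↘-gap-S (x₁ , x₂) (v₁ , v₂) = ring x₁ x₂ v₁ v₂
  where
  ring : ∀ x₁ x₂ v₁ v₂ → (v₁ - x₁) + (v₂ - x₂) ≡ 1ℤ + ((v₁ - (x₁ + 1ℤ)) + (v₂ - x₂))
  ring = solve-∀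

↘-gap-E : ∀ x v → ↘-gap x v ≡ sucℤ (↘-gap (E x) v)
↘-gap-E (x₁ , x₂) (v₁ , v₂) = ring x₁ x₂ v₁ v₂
  where
  ring : ∀ x₁ x₂ v₁ v₂ → (v₁ - x₁) + (v₂ - x₂) ≡ 1ℤ + ((v₁ - x₁) + (v₂ - (x₂ + 1ℤ)))
  ring = solve-∀

↗-gap-N : ∀ x v → ↗-gap x v ≡ sucℤ (↗-gap (N x) v)
↗-gap-N (x₁ , x₂) (v₁ , v₂) = ring x₁ x₂ v₁ v₂
  where
  ring : ∀ x₁ x₂ v₁ v₂ → (x₁ - v₁) + (v₂ - x₂) ≡ 1ℤ + (((x₁ - 1ℤ) - v₁) + (v₂ - x₂))
  ring = solve-∀

↗-gap-E : ∀ x v → ↗-gap x v ≡ sucℤ (↗-gap (E x) v)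
↗-gap-E (x₁ , x₂) (v₁ , v₂) = ring x₁ x₂ v₁ v₂
  where
  ring : ∀ x₁ x₂ v₁ v₂ → (x₁ - v₁) + (v₂ - x₂) ≡ 1ℤ + ((x₁ - v₁) + (v₂ - (x₂ + 1ℤ)))
  ring = solve-∀

SE-advance : ∀ {x v} → x ↘ v →
  x ≡ v ⊎ ∃[ y ] (SEStep x y × y ↘ v × ↘-gap x v ≡ sucℤ (↘-gap y v))
SE-advance {x₁ , x₂} {v₁ , v₂} (p₁ , p₂) with x₁ ≟ v₁ | x₂ ≟ v₂
... | yes refl | yes refl = inj₁ refl
... | no x₁≢v₁ | _ = inj₂ (_ , inj₁ refl , (i<j⇒i+1≤j (ℤ.≤∧≢⇒< p₁ x₁≢v₁) , p₂) , ↘-gap-S _ (v₁ , v₂))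
... | yes refl | no x₂≢v₂ = inj₂ (_ , inj₂ refl , (p₁ , i<j⇒i+1≤j (ℤ.≤∧≢⇒< p₂ x₂≢v₂)) , ↘-gap-E _ (x₁ , v₂))

SE-walk : ∀ {u v} → u ↘ v → ∃[ zs ] IsWalk SEStep u zs v
SE-walk {v = v} u↘v with walk-by-descent (λ x → ↘-gap x v) ↘-gap-nonneg ↘-gap≡0⇒≡ SE-advance u↘v
... | zs , p , _ = zs , p

SE-walk-↘ : ∀ {u zs v} → IsWalk SEStep u zs v → u ↘ v
SE-walk-↘ stop = ↘-refl
SE-walk-↘ (step r p) = ↘-trans (SEStep⇒↘ r) (SE-walk-↘ p)

SE-walk-between : ∀ {u zs v z} → IsWalk SEStep u zs v → z ∈ zs → u ↘ z × z ↘ v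
SE-walk-between (step r p) (here refl) = SEStep⇒↘ r , SE-walk-↘ p
SE-walk-between (step r p) (there z∈zs) with SE-walk-between p z∈zs
... | u′↘z , z↘v = ↘-trans (SEStep⇒↘ r) u′↘z , z↘v

module _ {τ : List Node} (skew : IsSkewShape τ) where

  corner-step-↗ : ∀ {u} → u ∈ τ → N u ∉ τ → E u ∉ τ →
    ∀ {x y} → x ↗ u → AnyStep x y → y ∈ τ → y ↗ u
  corner-step-↗ {u₁ , u₂} uτ N∉τ E∉τ {x₁ , x₂} (p₁ , p₂) (inj₁ refl) yτ with u₁ ≤? x₁ - 1ℤ
  ... | yes q = q , p₂
  ... | no q = ⊥-elim (N∉τ (skew yτ uτ (i<j⇒i≤j-1 (ℤ.≰⇒> q) , p₂) (i-1≤i u₁ , ℤ.≤-refl)))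
  corner-step-↗ {u₁ , u₂} uτ N∉τ E∉τ {x₁ , x₂} (p₁ , p₂) (inj₂ (inj₁ refl)) yτ with x₂ + 1ℤ ≤? u₂
  ... | yes q = p₁ , q
  ... | no q = ⊥-elim (E∉τ (skew uτ yτ (ℤ.≤-refl , i≤i+1 u₂) (p₁ , i<j⇒i+1≤j (ℤ.≰⇒> q))))
  corner-step-↗ _ _ _ {x₁ , x₂} (p₁ , p₂) (inj₂ (inj₂ (inj₁ refl))) _ =
    ℤ.≤-trans p₁ (i≤i+1 x₁) , p₂
  corner-step-↗ _ _ _ {x₁ , x₂} (p₁ , p₂) (inj₂ (inj₂ (inj₂ refl))) _ =
    p₁ , ℤ.≤-trans (i-1≤i x₂) p₂

  corner-walk-↗ : ∀ {u zs y} → u ∈ τ → N u ∉ τ → E u ∉ τ →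
    IsWalk AnyStep u zs y → (∀ {z} → z ∈ zs → z ∈ τ) → y ↗ u
  corner-walk-↗ uτ N∉τ E∉τ p zs⊆τ = walk-preserves (corner-step-↗ uτ N∉τ E∉τ) p zs⊆τ ↗-refl

  module _ (conn : IsConnected τ) {v₁ v₂ : ℤ} (vτ : (v₁ , v₂) ∈ τ) where

    NE-Progress : Node → Set
    NE-Progress x = x ≡ (v₁ , v₂) ⊎
      ∃[ y ] (NEStep x y × (y ∈ τ × y ↗ (v₁ , v₂)) × ↗-gap x (v₁ , v₂) ≡ sucℤ (↗-gap y (v₁ , v₂)))

    north : ∀ {x} → N x ∈ τ → N x ↗ (v₁ , v₂) → NE-Progress x
    north {x} Nxτ Nx↗v = inj₂ (N x , inj₁ refl , (Nxτ , Nx↗v) , ↗-gap-N x (v₁ , v₂))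

    east : ∀ {x} → E x ∈ τ → E x ↗ (v₁ , v₂) → NE-Progress x
    east {x} Exτ Ex↗v = inj₂ (E x , inj₂ refl , (Exτ , Ex↗v) , ↗-gap-E x (v₁ , v₂))

    NE-advance : ∀ {x} → x ∈ τ × x ↗ (v₁ , v₂) → NE-Progress x
    NE-advance {x₁ , x₂} (xτ , p₁ , p₂) with x₁ ≟ v₁ | x₂ ≟ v₂
    ... | yes refl | yes refl = inj₁ refl
    ... | yes refl | no x₂≢v₂ =
      east (skew xτ vτ (ℤ.≤-refl , i≤i+1 x₂) (ℤ.≤-refl , x₂+1≤v₂)) (p₁ , x₂+1≤v₂)
      where x₂+1≤v₂ = i<j⇒i+1≤j (ℤ.≤∧≢⇒< p₂ x₂≢v₂)
    ... | no x₁≢v₁ | yes refl =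
      north (skew vτ xτ (v₁≤x₁-1 , ℤ.≤-refl) (i-1≤i x₁ , ℤ.≤-refl)) (v₁≤x₁-1 , p₂)
      where v₁≤x₁-1 = i<j⇒i≤j-1 (ℤ.≤∧≢⇒< p₁ (x₁≢v₁ ∘ sym))
    ... | no x₁≢v₁ | no x₂≢v₂ with N (x₁ , x₂) ∈? τ | E (x₁ , x₂) ∈? τ
    ...   | yes Nxτ | _ = north Nxτ (i<j⇒i≤j-1 (ℤ.≤∧≢⇒< p₁ (x₁≢v₁ ∘ sym)) , p₂)
    ...   | no _ | yes Exτ = east Exτ (p₁ , i<j⇒i+1≤j (ℤ.≤∧≢⇒< p₂ x₂≢v₂))
    ...   | no N∉τ | no E∉τ with conn xτ vτ
    ...     | _ , p , _ , zs⊆τ =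
              ⊥-elim (x₁≢v₁ (cong proj₁ (↗-antisym (p₁ , p₂) (corner-walk-↗ xτ N∉τ E∉τ p zs⊆τ))))

    NE-walk-in : ∀ {u} → u ∈ τ → u ↗ (v₁ , v₂) →
      ∃[ zs ] (IsWalk NEStep u zs (v₁ , v₂) × PathIn τ u zs)
    NE-walk-in uτ u↗v
      with walk-by-descent (λ x → ↗-gap x (v₁ , v₂)) (↗-gap-nonneg ∘ proj₂)
             (↗-gap≡0⇒≡ ∘ proj₂) NE-advance (uτ , u↗v)
    ... | zs , p , zs-inside = zs , p , uτ , proj₁ ∘ zs-inside

↘⊎↗-total : ∀ u v → (u ↘ v ⊎ u ↗ v) ⊎ (v ↘ u ⊎ v ↗ u)
↘⊎↗-total (u₁ , u₂) (v₁ , v₂) with ℤ.≤-total u₁ v₁ | ℤ.≤-total u₂ v₂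
... | inj₁ u₁≤v₁ | inj₁ u₂≤v₂ = inj₁ (inj₁ (u₁≤v₁ , u₂≤v₂))
... | inj₂ v₁≤u₁ | inj₁ u₂≤v₂ = inj₁ (inj₂ (v₁≤u₁ , u₂≤v₂))
... | inj₂ v₁≤u₁ | inj₂ v₂≤u₂ = inj₂ (inj₁ (v₁≤u₁ , v₂≤u₂))
... | inj₁ u₁≤v₁ | inj₂ v₂≤u₂ = inj₂ (inj₂ (u₁≤v₁ , v₂≤u₂))

SEPathClosed : List Node → Set
SEPathClosed τ = ∀ {u v} → u ∈ τ → v ∈ τ → u ↘ v → ∀ zs → IsWalk SEStep u zs v → PathIn τ u zs

NEPathConnected : List Node → Set
NEPathConnected τ = ∀ {u v} → u ∈ τ → v ∈ τ → u ↗ v → ∃[ zs ] (IsWalk NEStep u zs v × PathIn τ u zs)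

module _ {τ : List Node} where

  skew⇒SEPathClosed : IsSkewShape τ → SEPathClosed τ
  skew⇒SEPathClosed skew uτ vτ _ _ p =
    uτ , λ z∈zs → skew uτ vτ (proj₁ (SE-walk-between p z∈zs)) (proj₂ (SE-walk-between p z∈zs))

  skew∧connected⇒NEPathConnected : IsSkewShape τ → IsConnected τ → NEPathConnected τ
  skew∧connected⇒NEPathConnected skew conn uτ vτ = NE-walk-in skew conn vτ uτ

  SEPathClosed⇒skew : SEPathClosed τ → IsSkewShape τ
  SEPathClosed⇒skew closed uτ wτ u↘v v↘w with SE-walk u↘v | SE-walk v↘w
  ... | zs , p | ys , q with walk-end p
  ...   | inj₁ refl = uτ
  ...   | inj₂ v∈zs = proj₂ (closed uτ wτ (↘-trans u↘v v↘w) (zs ++ ys) (walk-++ p q)) (∈-++⁺ˡ v∈zs)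

  module _ (closed : SEPathClosed τ) (reach : NEPathConnected τ) where

    comparable-path : ∀ {u v} → u ∈ τ → v ∈ τ → u ↘ v ⊎ u ↗ v →
      ∃[ zs ] (IsWalk AnyStep u zs v × PathIn τ u zs)
    comparable-path uτ vτ (inj₁ u↘v) with SE-walk u↘v
    ... | zs , p = zs , walk-map SEStep⇒AnyStep p , closed uτ vτ u↘v zs p
    comparable-path uτ vτ (inj₂ u↗v) with reach uτ vτ u↗v
    ... | zs , p , p∈τ = zs , walk-map NEStep⇒AnyStep p , p∈τ

    SEPathClosed∧NEPathConnected⇒skew∧connected : IsSkewShape τ × IsConnected τ
    SEPathClosed∧NEPathConnected⇒skew∧connected = SEPathClosed⇒skew closed , connected
      where
      connected : IsConnected τ
      connected {u} {v} uτ vτ with ↘⊎↗-total u v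
      ... | inj₁ u≤v = comparable-path uτ vτ u≤v
      ... | inj₂ v≤u with comparable-path vτ uτ v≤u
      ...   | _ , p , p∈τ = walk-reverse-in AnyStep-sym p p∈τ

proposition2p5 : (τ : List Node) →
    (IsSkewShape τ × IsConnected τ) ⇔
    (∀ {u v} → u ∈ τ → v ∈ τ →
      ((u ↘ v) → ∀ zs → IsWalk SEStep u zs v → PathIn τ u zs)
      × ((u ↗ v) → ∃[ zs ] (IsWalk NEStep u zs v × PathIn τ u zs)))
proposition2p5 τ = mk⇔
  (λ { (skew , conn) uτ vτ →
    skew⇒SEPathClosed skew uτ vτ , skew∧connected⇒NEPathConnected skew conn uτ vτ })
  (λ paths → SEPathClosed∧NEPathConnected⇒skew∧connected
    (λ uτ vτ → proj₁ (paths uτ vτ)) (λ uτ vτ → proj₂ (paths uτ vτ)))
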